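{- Let $d$ be a generator of $(\mathbb{Z}/q\mathbb{Z})^\times$ and $\sigma_q\in\mathrm{Gal}(\mathbb{Q}(\zeta)/\mathbb{Q})$ the automorphism with $\sigma_q(\zeta^q)=\zeta^q$ and $\sigma_q(\zeta^p)=\zeta^{pd}$. For $1\le i\le g$ let $t_i=\langle d b_i\rangle_q$, $t_i'=q-t_i$, $\iota_1=\kappa_{t_i-1}+a_i+1$ and $\iota_2=\kappa_{t_i'-1}+p-(a_i+1)$. Then ${}^{\sigma_q}\alpha$ (obtained by applying $\sigma_q$ to every entry of $\alpha$) is the block diagonal matrix whose $i$-th diagonal $2\times2$ block is $\alpha[\iota_1]$ if $0\le a_i\le k_{t_i}$, is $\overline{\alpha[\iota_2]}$ if $a_i>k_{t_i}$, and is $0$ otherwise.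
   Context: Let $p\neq q$ be odd primes and $g=(p-1)(q-1)/2$. Let $\zeta=e^{2\pi i/(pq)}$ and $Z=\mathrm{diag}(\zeta,\overline{\zeta})$. Notation: $\langle x\rangle_r$ is the representative of $x$ mod $r$ in $\{0,\dots,r-1\}$. For $1\le b\le q-1$ let $k_b=\lfloor (pb-q-1)/q\rfloor$; for $0\le t\le q-1$ let $\kappa_t=\sum_{1\le b\le t,\ k_b\ge0}(k_b+1)$ (so $\kappa_0=0$). The integer pairs $(a,b)$ with $1\le b\le q-1$, $0\le a\le k_b$ are exactly $g$ in number; order them by increasing $b$ then increasing $a$, and let $(a_i,b_i)$ be the $i$-th pair, so that the pair $(a,b)$ has index $\kappa_{b-1}+a+1$. Let $\alpha$ be the $2g\times2g$ block diagonal matrix whose $i$-th diagonal $2\times 2$ block is $\alpha[i]=Z^{q(a_i+1)-pb_i}$ (this is the matrix of the endomorphism of $\mathrm{Jac}(C_{p,q})$, $C_{p,q}:y^q=x^p-1$, induced by $(x,y)\mapsto(\zeta^q x,\zeta^p y)$ in a suitable symplectic basis). $\overline{X}$ denotes entrywise complex conjugation. -}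

module Defs where

open import Level using (Level)
open import Algebra.Bundles using (CommutativeRing; CommutativeSemiring)
open import Data.Nat as ℕ using (ℕ; zero; suc; NonZero; _∸_; _+_; _<_; _≤_)
open import Data.Nat.Properties using (m*n≢0)
open import Data.Integer as ℤ using (ℤ; +_; _/ℕ_; _%ℕ_)
open import Data.Integer.Properties as ℤP using ()
open import Data.List using (List; []; _∷_; map; concatMap; upTo)
open import Data.Maybe using (Maybe; just; nothing)
open import Data.Product using (_×_; _,_; ∃-syntax)
open import Relation.Nullary using (yes; no)
open import Relation.Binary.PropositionalEquality using (_≡_)
import Algebra.Definitions.RawSemiring as RSD

-- d is a generator of (ℤ/qℤ)^×  (q prime, so (ℤ/qℤ)^× = {1,…,q-1});
-- d is given by its representative in {0,…,q-1}.
IsGeneratorMod : (q d : ℕ) → .{{_ : NonZero q}} → Set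
IsGeneratorMod q d =
  d < q × (∀ x → 1 ≤ x → x < q → ∃[ k ] ((d ℕ.^ k) ℕ.% q ≡ x))

genus : ℕ → ℕ → ℕ
genus p q = ((p ∸ 1) ℕ.* (q ∸ 1)) ℕ./ 2

kk : (p q b : ℕ) → .{{_ : NonZero q}} → ℤ
kk p q b = (+ (p ℕ.* b) ℤ.- + q ℤ.- ℤ.1ℤ) /ℕ q

cnt : (p q b : ℕ) → .{{_ : NonZero q}} → ℕ
cnt p q b with ℤ.0ℤ ℤ.≤? kk p q b
... | yes _ = ℤ.∣ kk p q b ℤ.+ ℤ.1ℤ ∣
... | no  _ = 0

κ : (p q t : ℕ) → .{{_ : NonZero q}} → ℕ
κ p q zero    = 0
κ p q (suc t) = κ p q t + cnt p q (suc t)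

-- the pairs (a,b), 1 ≤ b ≤ q-1, 0 ≤ a ≤ k_b, ordered by increasing b then
-- increasing a
pairs : (p q : ℕ) → .{{_ : NonZero q}} → List (ℕ × ℕ)
pairs p q = concatMap (λ b → map (λ a → (a , b)) (upTo (cnt p q b)))
                      (map suc (upTo (q ∸ 1)))

nth : {A : Set} → List A → ℕ → Maybe A
nth []       _       = nothing
nth (x ∷ xs) zero    = just x
nth (x ∷ xs) (suc n) = nth xs n

-- the i-th pair (a_i , b_i), 1-indexed (nothing if i ∉ {1,…,g})
pairAt : (p q i : ℕ) → .{{_ : NonZero q}} → Maybe (ℕ × ℕ)
pairAt p q zero    = nothing
pairAt p q (suc i) = nth (pairs p q) i

-- Matrices over a commutative ring R containing ζ with ζ^(pq) = 1.
-- A matrix is a function ℕ → ℕ → Carrier (row, column, 0-indexed);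
-- a 2×2 block uses indices 0,1.

module RingDefs {c ℓ : Level} (R : CommutativeRing c ℓ) where
  open CommutativeRing R
  open RSD (CommutativeSemiring.rawSemiring commutativeSemiring) using (_^_) public

  Mat : Set c
  Mat = ℕ → ℕ → Carrier

  zeroM : Mat
  zeroM _ _ = 0#

  mapM : (Carrier → Carrier) → Mat → Mat
  mapM f M r s = f (M r s)

  -- block diagonal matrix whose i-th (1-indexed) 2×2 diagonal block is B i
  blockDiag : (ℕ → Mat) → Mat
  blockDiag B r s with r ℕ./ 2 ℕ.≟ s ℕ./ 2
  ... | yes _ = B (suc (r ℕ./ 2)) (r ℕ.% 2) (s ℕ.% 2)
  ... | no  _ = 0#

  module _ (ζ : Carrier) (p q : ℕ) .{{_ : NonZero p}} .{{_ : NonZero q}} where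

    private instance
      pq≢0 : NonZero (p ℕ.* q)
      pq≢0 = m*n≢0 p q

    -- ζ^e for e ∈ ℤ (meaningful since ζ^(pq) = 1)
    zpow : ℤ → Carrier
    zpow e = ζ ^ (e %ℕ (p ℕ.* q))

    Zpow : ℤ → Mat
    Zpow e 0 0 = zpow e
    Zpow e 1 1 = zpow (ℤ.- e)
    Zpow e _ _ = 0#

    αblk : ℕ → Mat
    αblk i with pairAt p q i
    ... | just (a , b) = Zpow (+ (q ℕ.* (a ℕ.+ 1)) ℤ.- + (p ℕ.* b))
    ... | nothing      = zeroM

    -- α[ι] for an integer index ι (zero block if ι ≤ 0)
    αblkℤ : ℤ → Mat
    αblkℤ (+ n)      = αblk n
    αblkℤ ℤ.-[1+ _ ] = zeroM

    α : Mat
    α = blockDiag αblk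

    -- the claimed value of ^{σ_q}α, given d and the conjugation map
    module _ (d : ℕ) (conj : Carrier → Carrier) where

      βblk : ℕ → Mat
      βblk i with pairAt p q i
      ... | nothing      = zeroM
      ... | just (a , b) = choose
        where
          t  = (d ℕ.* b) ℕ.% q
          t′ = q ∸ t
          ι₁ : ℤ
          ι₁ = + (κ p q (t ∸ 1)) ℤ.+ + a ℤ.+ ℤ.1ℤ
          ι₂ : ℤ
          ι₂ = + (κ p q (t′ ∸ 1)) ℤ.+ + p ℤ.- (+ a ℤ.+ ℤ.1ℤ)
          choose : Mat
          choose with + a ℤ.≤? kk p q t
          ... | yes _ = αblkℤ ι₁
          ... | no  _ with kk p q t ℤ.<? + a
          ...   | yes _ = mapM conj (αblkℤ ι₂)
          ...   | no  _ = zeroM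

      β : Mat
      β = blockDiag βblk

-- Write α[i] = Z^e(a,b) for the i-th pair (a,b), with e(a,b) = q(a+1) − pb read modulo pq.
-- Since σ fixes ζ^q and sends ζ^p to ζ^(pd), it maps Z^e(a,b) to Z^e(a,t) with t = ⟨db⟩_q,
-- and t ≠ 0 because d is a unit mod q.  If a ≤ k_t then (a,t) is itself a pair, sitting at
-- position κ_(t−1)+a+1.  Otherwise pt < q(a+1) (equality would make the prime p divide q(a+1)
-- with a+1 < p), so (a′,t′) = (p−2−a, q−t) is a pair, sitting at position ι₂, and
-- e(a,t) = −e(a′,t′); as conjugation inverts ζ, the conjugate of its block is Z^e(a,t).
-- In particular the third case of the statement never occurs.

module Submission where

open import Defs
open import Level using (Level)
open import Algebra.Bundles using (CommutativeRing)
open import Algebra.Morphism.Structures using (module RingMorphisms)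
import Algebra.Properties.Semiring.Exp as Exp
open import Data.Nat as ℕ using (ℕ; zero; suc; NonZero; _+_; _*_; _∸_; _<_; _≤_; s≤s; z≤n; z<s)
import Data.Nat.Properties as ℕ
open import Data.Nat.DivMod using (_%_; _/_; m%n<n; m≡m%n+[m/n]*n; m<n⇒m%n≡m)
open import Data.Nat.Divisibility using (_∣_; ∣-refl; >⇒∤; m%n≡0⇒n∣m; divides)
open import Data.Nat.Primality using (Prime; euclidsLemma; prime⇒irreducible; prime⇒nonTrivial)
open import Data.Integer as ℤ using (ℤ; +_; -[1+_]; _%ℕ_; _/ℕ_)
import Data.Integer.Properties as ℤ
open import Data.Integer.DivMod using (a≡a%ℕn+[a/ℕn]*n; [n/ℕd]*d≤n; n<s[n/ℕd]*d)
open import Data.Integer.Divisibility.Signed using (divides; ∣m∣n⇒∣m+n; ∣m⇒∣-m; ∣n⇒∣m*n)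
  renaming (_∣_ to _∣ℤ_)
open import Data.Integer.Tactic.RingSolver using (solve-∀)
open import Data.List using (List; []; _∷_; _++_; _∷ʳ_; [_]; length; map; upTo; concatMap)
open import Data.List.Properties
  using (++-assoc; ++-identityʳ; map-++; length-map; length-++; length-upTo; upTo-∷ʳ; concatMap-++)
open import Data.List.Membership.Propositional using (_∈_)
open import Data.List.Membership.Propositional.Properties using (∈-map⁻; ∈-concat⁻′; ∈-upTo⁻)
open import Data.List.Relation.Unary.Any using (here; there)
open import Data.Maybe using (just; nothing)
open import Data.Product using (_×_; _,_; proj₁; proj₂; ∃-syntax)
open import Data.Sum using (inj₁; inj₂)
open import Function.Base using (_∘_)
open import Function.Bundles using (_⇔_; mk⇔; Equivalence)
open import Function.Construct.Composition using (_⇔-∘_)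
open import Relation.Nullary using (¬_; yes; no)
open import Relation.Nullary.Negation using (contradiction)
open import Relation.Binary.PropositionalEquality as ≡ using (_≡_; _≢_; cong; cong₂)

module _ {A : Set} where

  nth-++ʳ : ∀ (xs ys : List A) k → nth (xs ++ ys) (length xs + k) ≡ nth ys k
  nth-++ʳ []       ys k = ≡.refl
  nth-++ʳ (x ∷ xs) ys k = nth-++ʳ xs ys k

  nth-length : ∀ (xs : List A) x ys → nth (xs ++ x ∷ ys) (length xs) ≡ just x
  nth-length []       x ys = ≡.refl
  nth-length (_ ∷ xs) x ys = nth-length xs x ys

  nth-at-length : ∀ (xs ys : List A) x zs ws → nth (xs ++ (ys ++ x ∷ zs) ++ ws) (length xs + length ys) ≡ just x
  nth-at-length xs ys x zs ws = ≡.trans (nth-++ʳ xs ((ys ++ x ∷ zs) ++ ws) (length ys))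
    (≡.trans (cong (λ l → nth l (length ys)) (++-assoc ys (x ∷ zs) ws)) (nth-length ys x (zs ++ ws)))

  nth⇒∈ : ∀ (xs : List A) k {x} → nth xs k ≡ just x → x ∈ xs
  nth⇒∈ (y ∷ xs) zero    ≡.refl = here ≡.refl
  nth⇒∈ (y ∷ xs) (suc k) eq   = there (nth⇒∈ xs k eq)

upTo-split : ∀ {t m} → t < m → ∃[ rest ] upTo m ≡ upTo t ++ t ∷ rest
upTo-split {t} {suc m} t<1+m with ℕ.m<1+n⇒m<n∨m≡n t<1+m
... | inj₂ ≡.refl = [] , ≡.sym (upTo-∷ʳ t)
... | inj₁ t<m with upTo-split t<m
...   | rest , eq = rest ∷ʳ m , (begin
  upTo (suc m)               ≡⟨ upTo-∷ʳ m ⟨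
  upTo m ∷ʳ m                ≡⟨ cong (_∷ʳ m) eq ⟩
  (upTo t ++ t ∷ rest) ∷ʳ m  ≡⟨ ++-assoc (upTo t) (t ∷ rest) [ m ] ⟩
  upTo t ++ t ∷ rest ∷ʳ m    ∎)
  where open ≡.≡-Reasoning

map-upTo-split : ∀ {B : Set} (f : ℕ → B) {t m} → t < m → ∃[ rest ] map f (upTo m) ≡ map f (upTo t) ++ f t ∷ rest
map-upTo-split f {t} t<m with upTo-split t<m
... | rest , eq = map f rest , ≡.trans (cong (map f) eq) (map-++ f (upTo t) (t ∷ rest))

suc<⇔<∸1 : ∀ {m n} → suc m < n ⇔ m < n ∸ 1
suc<⇔<∸1 {n = suc n} = mk⇔ ℕ.s<s⁻¹ s≤s
suc<⇔<∸1 {n = zero}  = mk⇔ (λ ()) (λ ())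

prime>1 : ∀ {p} → Prime p → 1 < p
prime>1 {p} p-prime = ℕ.nonTrivial⇒n>1 p ⦃ prime⇒nonTrivial p-prime ⦄

odd-prime>2 : ∀ {q} → Prime q → ¬ (2 ∣ q) → 2 < q
odd-prime>2 q-prime 2∤q with ℕ.m≤n⇒m<n∨m≡n (prime>1 q-prime)
... | inj₁ 2<q = 2<q
... | inj₂ ≡.refl = contradiction ∣-refl 2∤q

-- The powers of 0 are 1 and 0, so for q > 2 they miss 2.
generator>0 : ∀ {q d} .{{_ : NonZero q}} → 2 < q → IsGeneratorMod q d → 0 < d
generator>0 {d = suc _} _ _ = z<s
generator>0 {q} {zero} 2<q (_ , generates) with generates 2 (s≤s z≤n) 2<q
... | zero  , 1%q≡2 = contradiction (≡.trans (≡.sym (m<n⇒m%n≡m (ℕ.<-trans (s≤s (s≤s z≤n)) 2<q))) 1%q≡2) λ ()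
... | suc _ , 0%q≡2 = contradiction (≡.trans (≡.sym (m<n⇒m%n≡m (ℕ.<-trans z<s 2<q))) 0%q≡2) λ ()

d*b%q>0 : ∀ {q d b} .{{_ : NonZero q}} → Prime q → 0 < d → d < q → 0 < b → b < q → 0 < (d * b) % q
d*b%q>0 {q} {d} {b} q-prime 0<d d<q 0<b b<q with (d * b) % q in db%q≡r
... | suc _ = z<s
... | zero with euclidsLemma d b q-prime (m%n≡0⇒n∣m (d * b) q db%q≡r)
...   | inj₁ q∣d = contradiction q∣d (>⇒∤ ⦃ ℕ.>-nonZero 0<d ⦄ d<q)
...   | inj₂ q∣b = contradiction q∣b (>⇒∤ ⦃ ℕ.>-nonZero 0<b ⦄ b<q)

p*t≢q*s : ∀ {p q s} t → Prime p → Prime q → p ≢ q → 0 < s → s < p → p * t ≢ q * s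
p*t≢q*s {p} {q} {s} t p-prime q-prime p≢q 0<s s<p pt≡qs
  with euclidsLemma q s p-prime (divides t (≡.trans (≡.sym pt≡qs) (ℕ.*-comm p t)))
... | inj₂ p∣s = contradiction p∣s (>⇒∤ ⦃ ℕ.>-nonZero 0<s ⦄ s<p)
... | inj₁ p∣q with prime⇒irreducible q-prime p∣q
...   | inj₁ p≡1 = contradiction p≡1 (ℕ.>⇒≢ (prime>1 p-prime))
...   | inj₂ p≡q = contradiction p≡q p≢q

q*[1+a]<p*b⇒1+a<p : ∀ {p q a b} → q * suc a < p * b → b < q → suc a < p
q*[1+a]<p*b⇒1+a<p {p} {q} {a} {b} qa<pb b<q =
  ℕ.*-cancelˡ-< q (suc a) p
    (ℕ.<-≤-trans qa<pb (≡.subst (p * b ≤_) (ℕ.*-comm p q) (ℕ.*-monoʳ-≤ p (ℕ.<⇒≤ b<q))))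

complement-sum : ∀ {p q a a′ t t′} → suc a + suc a′ ≡ p → t + t′ ≡ q →
                 q * suc a + q * suc a′ ≡ p * t + p * t′
complement-sum {p} {q} {a} {a′} {t} {t′} a+a′≡p t+t′≡q = begin
  q * suc a + q * suc a′  ≡⟨ ℕ.*-distribˡ-+ q (suc a) (suc a′) ⟨
  q * (suc a + suc a′)    ≡⟨ cong (q *_) a+a′≡p ⟩
  q * p                   ≡⟨ ℕ.*-comm q p ⟩
  p * q                   ≡⟨ cong (p *_) t+t′≡q ⟨
  p * (t + t′)            ≡⟨ ℕ.*-distribˡ-+ p t t′ ⟩
  p * t + p * t′          ∎
  where open ≡.≡-Reasoning

complement-< : ∀ {p q a a′ t t′} → suc a + suc a′ ≡ p → t + t′ ≡ q →
               p * t < q * suc a → q * suc a′ < p * t′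
complement-< {p} {q} {a} {a′} {t} {t′} a+a′≡p t+t′≡q pt<qa = ℕ.+-cancelˡ-< (p * t) (q * suc a′) (p * t′)
  (≡.subst (p * t + q * suc a′ <_) (complement-sum a+a′≡p t+t′≡q) (ℕ.+-monoˡ-< (q * suc a′) pt<qa))

≤/ℕ⇔*≤ : ∀ i n d .{{_ : NonZero d}} → i ℤ.≤ n /ℕ d ⇔ i ℤ.* + d ℤ.≤ n
≤/ℕ⇔*≤ i n d = mk⇔
  (λ i≤n/d → ℤ.≤-trans (ℤ.*-monoʳ-≤-nonNeg (+ d) i≤n/d) ([n/ℕd]*d≤n n d))
  (λ id≤n → ℤ.≤-trans
    (ℤ.i<j⇒i≤pred[j] (ℤ.*-cancelʳ-<-nonNeg {j = ℤ.suc (n /ℕ d)} (+ d) (ℤ.≤-<-trans id≤n (n<s[n/ℕd]*d n d))))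
    (ℤ.≤-reflexive (ℤ.pred-suc (n /ℕ d))))

i≤j-k-l⇔i+[k+l]≤j : ∀ i j k l → i ℤ.≤ j ℤ.- k ℤ.- l ⇔ i ℤ.+ (k ℤ.+ l) ℤ.≤ j
i≤j-k-l⇔i+[k+l]≤j i j k l = mk⇔
  (λ i≤j-k-l → ℤ.≤-trans (ℤ.+-monoˡ-≤ (k ℤ.+ l) i≤j-k-l) (ℤ.≤-reflexive (subtract-add j k l)))
  (λ i+k+l≤j → ℤ.≤-trans (ℤ.≤-reflexive (≡.sym (add-subtract i k l)))
                          (ℤ.+-monoˡ-≤ (ℤ.- l) (ℤ.+-monoˡ-≤ (ℤ.- k) i+k+l≤j)))
  where
  subtract-add : ∀ x k l → x ℤ.- k ℤ.- l ℤ.+ (k ℤ.+ l) ≡ x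
  subtract-add = solve-∀
  add-subtract : ∀ x k l → x ℤ.+ (k ℤ.+ l) ℤ.- k ℤ.- l ≡ x
  add-subtract = solve-∀

m-n≡-[m′-n′] : ∀ {m n m′ n′} → m + m′ ≡ n + n′ → + m ℤ.- + n ≡ ℤ.- (+ m′ ℤ.- + n′)
m-n≡-[m′-n′] {m} {n} {m′} {n′} m+m′≡n+n′ = begin
  + m ℤ.- + n                                       ≡⟨ expand (+ m) (+ n) (+ m′) (+ n′) ⟩
  + (m + m′) ℤ.- + (n + n′) ℤ.- (+ m′ ℤ.- + n′)     ≡⟨ cong (λ k → + k ℤ.- + (n + n′) ℤ.- (+ m′ ℤ.- + n′)) m+m′≡n+n′ ⟩
  + (n + n′) ℤ.- + (n + n′) ℤ.- (+ m′ ℤ.- + n′)     ≡⟨ cancel (+ (n + n′)) (+ m′ ℤ.- + n′) ⟩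
  ℤ.- (+ m′ ℤ.- + n′)                               ∎
  where
  open ≡.≡-Reasoning
  expand : ∀ m n m′ n′ → m ℤ.- n ≡ (m ℤ.+ m′) ℤ.- (n ℤ.+ n′) ℤ.- (m′ ℤ.- n′)
  expand = solve-∀
  cancel : ∀ k x → k ℤ.- k ℤ.- x ≡ ℤ.- x
  cancel = solve-∀

n∣i-i%ℕn : ∀ i n .{{_ : NonZero n}} → + n ∣ℤ i ℤ.- + (i %ℕ n)
n∣i-i%ℕn i n = divides (i /ℕ n) (begin
  i ℤ.- + (i %ℕ n)                              ≡⟨ cong (ℤ._- + (i %ℕ n)) (a≡a%ℕn+[a/ℕn]*n i n) ⟩
  + (i %ℕ n) ℤ.+ i /ℕ n ℤ.* + n ℤ.- + (i %ℕ n)  ≡⟨ cancel (+ (i %ℕ n)) (i /ℕ n ℤ.* + n) ⟩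
  i /ℕ n ℤ.* + n                                ∎)
  where
  open ≡.≡-Reasoning
  cancel : ∀ r s → r ℤ.+ s ℤ.- r ≡ s
  cancel = solve-∀

∣i-j⇒∣j-i : ∀ {k} i j → k ∣ℤ i ℤ.- j → k ∣ℤ j ℤ.- i
∣i-j⇒∣j-i {k} i j k∣i-j = ≡.subst (k ∣ℤ_) (flip i j) (∣m⇒∣-m k∣i-j)
  where
  flip : ∀ i j → ℤ.- (i ℤ.- j) ≡ j ℤ.- i
  flip = solve-∀

∣i-j∣j-k⇒∣i-k : ∀ {k} i j l → k ∣ℤ i ℤ.- j → k ∣ℤ j ℤ.- l → k ∣ℤ i ℤ.- l
∣i-j∣j-k⇒∣i-k {k} i j l k∣i-j k∣j-l =
  ≡.subst (k ∣ℤ_) (ℤ.+-minus-telescope i j l) (∣m∣n⇒∣m+n k∣i-j k∣j-l)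

m-n≡k*d⇒m≡n+k*d : ∀ m n k d → + m ℤ.- + n ≡ + k ℤ.* + d → m ≡ n + k * d
m-n≡k*d⇒m≡n+k*d m n k d eq = ℤ.+-injective (begin
  + m                     ≡⟨ split (+ m) (+ n) ⟩
  + n ℤ.+ (+ m ℤ.- + n)   ≡⟨ cong (ℤ._+_ (+ n)) eq ⟩
  + n ℤ.+ + k ℤ.* + d     ≡⟨ cong (ℤ._+_ (+ n)) (ℤ.pos-* k d) ⟨
  + (n + k * d)           ∎)
  where
  open ≡.≡-Reasoning
  split : ∀ i j → i ≡ j ℤ.+ (i ℤ.- j)
  split = solve-∀

n∣[n∸1]m+m : ∀ n m .{{_ : NonZero n}} → + n ∣ℤ + ((n ∸ 1) * m) ℤ.- ℤ.- + m
n∣[n∸1]m+m n m = divides (+ m) (begin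
  + ((n ∸ 1) * m) ℤ.- ℤ.- + m  ≡⟨ cong (ℤ._+_ (+ ((n ∸ 1) * m))) (ℤ.neg-involutive (+ m)) ⟩
  + ((n ∸ 1) * m + m)          ≡⟨ cong +_ [n∸1]m+m≡nm ⟩
  + (n * m)                    ≡⟨ cong +_ (ℕ.*-comm n m) ⟩
  + (m * n)                    ≡⟨ ℤ.pos-* m n ⟩
  + m ℤ.* + n                  ∎)
  where
  open ≡.≡-Reasoning
  [n∸1]m+m≡nm : (n ∸ 1) * m + m ≡ n * m
  [n∸1]m+m≡nm = begin
    (n ∸ 1) * m + m      ≡⟨ cong (_+_ ((n ∸ 1) * m)) (ℕ.*-identityˡ m) ⟨
    (n ∸ 1) * m + 1 * m  ≡⟨ ℕ.*-distribʳ-+ m (n ∸ 1) 1 ⟨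
    (n ∸ 1 + 1) * m      ≡⟨ cong (_* m) (ℕ.m∸n+n≡m (ℕ.>-nonZero⁻¹ n)) ⟩
    n * m                ∎

qx+py-cong : ∀ p q {x x′ y y′} → + p ∣ℤ x ℤ.- x′ → + q ∣ℤ y ℤ.- y′ →
             + (p * q) ∣ℤ (+ q ℤ.* x ℤ.+ + p ℤ.* y) ℤ.- (+ q ℤ.* x′ ℤ.+ + p ℤ.* y′)
qx+py-cong p q {x} {x′} {y} {y′} (divides k x-x′≡kp) (divides l y-y′≡lq) = divides (k ℤ.+ l) (begin
  (+ q ℤ.* x ℤ.+ + p ℤ.* y) ℤ.- (+ q ℤ.* x′ ℤ.+ + p ℤ.* y′)  ≡⟨ regroup (+ p) (+ q) x x′ y y′ ⟩
  + q ℤ.* (x ℤ.- x′) ℤ.+ + p ℤ.* (y ℤ.- y′)                  ≡⟨ cong₂ (λ u v → + q ℤ.* u ℤ.+ + p ℤ.* v) x-x′≡kp y-y′≡lq ⟩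
  + q ℤ.* (k ℤ.* + p) ℤ.+ + p ℤ.* (l ℤ.* + q)                ≡⟨ collect (+ p) (+ q) k l ⟩
  (k ℤ.+ l) ℤ.* (+ p ℤ.* + q)                                ≡⟨ cong ((k ℤ.+ l) ℤ.*_) (ℤ.pos-* p q) ⟨
  (k ℤ.+ l) ℤ.* + (p * q)                                    ∎)
  where
  open ≡.≡-Reasoning
  regroup : ∀ p q x x′ y y′ →
            (q ℤ.* x ℤ.+ p ℤ.* y) ℤ.- (q ℤ.* x′ ℤ.+ p ℤ.* y′) ≡ q ℤ.* (x ℤ.- x′) ℤ.+ p ℤ.* (y ℤ.- y′)
  regroup = solve-∀
  collect : ∀ p q k l → q ℤ.* (k ℤ.* p) ℤ.+ p ℤ.* (l ℤ.* q) ≡ (k ℤ.+ l) ℤ.* (p ℤ.* q)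
  collect = solve-∀

-- The pairs (a , b) and their positions

<∣k+1∣⇔≤ : ∀ {k} a → ℤ.0ℤ ℤ.≤ k → a < ℤ.∣ k ℤ.+ ℤ.1ℤ ∣ ⇔ + a ℤ.≤ k
<∣k+1∣⇔≤ {+ k} a _ = mk⇔
  (λ a<k+1 → ℤ.+≤+ (ℕ.m<1+n⇒m≤n (≡.subst (a <_) (ℕ.+-comm k 1) a<k+1)))
  (λ { (ℤ.+≤+ a≤k) → ≡.subst (a <_) (ℕ.+-comm 1 k) (s≤s a≤k) })

<cnt⇔≤kk : ∀ p q .{{_ : NonZero q}} a b → a < cnt p q b ⇔ + a ℤ.≤ kk p q b
<cnt⇔≤kk p q a b with ℤ.0ℤ ℤ.≤? kk p q b
... | yes 0≤k = <∣k+1∣⇔≤ a 0≤k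
... | no 0≰k = mk⇔ (λ ()) (λ a≤k → contradiction (ℤ.≤-trans (ℤ.+≤+ z≤n) a≤k) 0≰k)

≤kk⇔ : ∀ p q .{{_ : NonZero q}} a b → + a ℤ.≤ kk p q b ⇔ q * suc a < p * b
≤kk⇔ p q a b = mk⇔
  (λ a≤kk → ℤ.drop‿+≤+ (≡.subst (ℤ._≤ + (p * b)) cast (Equivalence.to ≤-shifted a≤kk)))
  (λ qa<pb → Equivalence.from ≤-shifted (≡.subst (ℤ._≤ + (p * b)) (≡.sym cast) (ℤ.+≤+ qa<pb)))
  where
  ≤-shifted : + a ℤ.≤ kk p q b ⇔ + a ℤ.* + q ℤ.+ (+ q ℤ.+ ℤ.1ℤ) ℤ.≤ + (p * b)
  ≤-shifted = i≤j-k-l⇔i+[k+l]≤j (+ a ℤ.* + q) (+ (p * b)) (+ q) ℤ.1ℤ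
          ⇔-∘ ≤/ℕ⇔*≤ (+ a) (+ (p * b) ℤ.- + q ℤ.- ℤ.1ℤ) q
  cast : + a ℤ.* + q ℤ.+ (+ q ℤ.+ ℤ.1ℤ) ≡ + suc (q * suc a)
  cast = ≡.trans (rearrange (+ a) (+ q)) (cong (ℤ._+_ ℤ.1ℤ) (≡.sym (ℤ.pos-* q (suc a))))
    where
    rearrange : ∀ a q → a ℤ.* q ℤ.+ (q ℤ.+ ℤ.1ℤ) ≡ ℤ.1ℤ ℤ.+ q ℤ.* (ℤ.1ℤ ℤ.+ a)
    rearrange = solve-∀

<cnt⇔ : ∀ p q .{{_ : NonZero q}} a b → a < cnt p q b ⇔ q * suc a < p * b
<cnt⇔ p q a b = ≤kk⇔ p q a b ⇔-∘ <cnt⇔≤kk p q a b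

-- One of the g pairs: 1 ≤ b ≤ q − 1 and a ≤ k_b, the latter in the form q(a+1) < pb of ≤kk⇔.
IsPair : (p q a b : ℕ) → Set
IsPair p q a b = 0 < b × b < q × q * suc a < p * b

module PairList (p q : ℕ) .{{_ : NonZero q}} where

  column : ℕ → List (ℕ × ℕ)
  column b = map (λ a → (a , b)) (upTo (cnt p q b))

  -- pairs p q is columns (q ∸ 1) by definition.
  columns : ℕ → List (ℕ × ℕ)
  columns t = concatMap column (map suc (upTo t))

  columns-split : ∀ {t m} → t < m → ∃[ rest ] columns m ≡ columns t ++ column (suc t) ++ rest
  columns-split {t} t<m with map-upTo-split suc t<m
  ... | rest , eq = concatMap column rest ,
    ≡.trans (cong (concatMap column) eq) (concatMap-++ column (map suc (upTo t)) (suc t ∷ rest))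

  length-columns : ∀ t → length (columns t) ≡ κ p q t
  length-columns zero    = ≡.refl
  length-columns (suc t) = begin
    length (columns (suc t))                               ≡⟨ cong (length ∘ concatMap column ∘ map suc) (upTo-∷ʳ t) ⟨
    length (concatMap column (map suc (upTo t ∷ʳ t)))      ≡⟨ cong (length ∘ concatMap column) (map-++ suc (upTo t) [ t ]) ⟩
    length (concatMap column (map suc (upTo t) ∷ʳ suc t))  ≡⟨ cong length (concatMap-++ column (map suc (upTo t)) [ suc t ]) ⟩
    length (columns t ++ column (suc t) ++ [])             ≡⟨ length-++ (columns t) ⟩
    length (columns t) + length (column (suc t) ++ [])     ≡⟨ cong₂ _+_ (length-columns t) length-column ⟩
    κ p q t + cnt p q (suc t)                              ∎
    where
    open ≡.≡-Reasoning
    length-column : length (column (suc t) ++ []) ≡ cnt p q (suc t)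
    length-column = ≡.trans (cong length (++-identityʳ (column (suc t))))
                      (≡.trans (length-map _ (upTo (cnt p q (suc t)))) (length-upTo (cnt p q (suc t))))

  pairAt-index : ∀ {a b} → IsPair p q a b → pairAt p q (suc (κ p q (b ∸ 1) + a)) ≡ just (a , b)
  pairAt-index {a} {suc t} (_ , b<q , qa<pb)
    with columns-split (Equivalence.to suc<⇔<∸1 b<q)
       | map-upTo-split (λ a′ → (a′ , suc t)) (Equivalence.from (<cnt⇔ p q a (suc t)) qa<pb)
  ... | rest , cols≡ | rest′ , col≡ =
    ≡.trans (cong₂ nth (≡.trans cols≡ (cong (λ col → columns t ++ col ++ rest) col≡))
                       (≡.sym (cong₂ _+_ (length-columns t) length-before)))
            (nth-at-length (columns t) before (a , suc t) rest′ rest)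
    where
    before = map (λ a′ → (a′ , suc t)) (upTo a)
    length-before : length before ≡ a
    length-before = ≡.trans (length-map _ (upTo a)) (length-upTo a)

  pairAt-valid : ∀ i {a b} → pairAt p q i ≡ just (a , b) → IsPair p q a b
  pairAt-valid (suc k) eq with ∈-concat⁻′ (map column (map suc (upTo (q ∸ 1)))) (nth⇒∈ (pairs p q) k eq)
  ... | _ , ab∈col , col∈cols with ∈-map⁻ column col∈cols
  ...   | _ , b∈ , ≡.refl with ∈-map⁻ suc b∈ | ∈-map⁻ _ ab∈col
  ...     | b₀ , b₀∈ , ≡.refl | _ , a∈ , ≡.refl =
    s≤s z≤n , Equivalence.from suc<⇔<∸1 (∈-upTo⁻ b₀∈) , Equivalence.to (<cnt⇔ p q _ _) (∈-upTo⁻ a∈)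

-- Powers of a root of unity

module RingPowers {c ℓ : Level} (R : CommutativeRing c ℓ) where
  open CommutativeRing R hiding (_+_) renaming (_*_ to _·_)
  open RingDefs R using (_^_)
  open RingMorphisms rawRing rawRing using (IsRingHomomorphism)
  open Exp semiring using (^-homo-*; ^-assocʳ; ^-congˡ; ^-congʳ)
  open import Relation.Binary.Reasoning.Setoid setoid

  1^ : ∀ m → 1# ^ m ≈ 1#
  1^ zero    = refl
  1^ (suc m) = trans (*-identityˡ _) (1^ m)

  homo-^ : ∀ {f} → IsRingHomomorphism f → ∀ x m → f (x ^ m) ≈ f x ^ m
  homo-^ f-homo x zero    = 1#-homo  where open IsRingHomomorphism f-homo
  homo-^ f-homo x (suc m) = trans (*-homo x (x ^ m)) (*-cong refl (homo-^ f-homo x m))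
    where open IsRingHomomorphism f-homo

  module RootOfUnity (n : ℕ) .{{_ : NonZero n}} (ζ : Carrier) (ζⁿ≈1 : ζ ^ n ≈ 1#) where

    ζ^ℤ : ℤ → Carrier
    ζ^ℤ e = ζ ^ (e %ℕ n)

    ^-periodic : ∀ m k → ζ ^ (m + k * n) ≈ ζ ^ m
    ^-periodic m k = begin
      ζ ^ (m + k * n)      ≈⟨ ^-homo-* ζ m (k * n) ⟩
      ζ ^ m · ζ ^ (k * n)  ≈⟨ *-cong refl (^-congʳ ζ (ℕ.*-comm k n)) ⟩
      ζ ^ m · ζ ^ (n * k)  ≈⟨ *-cong refl (sym (^-assocʳ ζ n k)) ⟩
      ζ ^ m · (ζ ^ n) ^ k  ≈⟨ *-cong refl (trans (^-congˡ k ζⁿ≈1) (1^ k)) ⟩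
      ζ ^ m · 1#           ≈⟨ *-identityʳ _ ⟩
      ζ ^ m                ∎

    ^-cong-∣ : ∀ m m′ → + n ∣ℤ + m ℤ.- + m′ → ζ ^ m ≈ ζ ^ m′
    ^-cong-∣ m m′ (divides (+ k) eq) =
      trans (reflexive (cong (ζ ^_) (m-n≡k*d⇒m≡n+k*d m m′ k n eq))) (^-periodic m′ k)
    ^-cong-∣ m m′ (divides -[1+ k ] eq) =
      sym (trans (reflexive (cong (ζ ^_) (m-n≡k*d⇒m≡n+k*d m′ m (suc k) n m′-m≡[1+k]n))) (^-periodic m (suc k)))
      where
      flip : ∀ i j → j ℤ.- i ≡ ℤ.- (i ℤ.- j)
      flip = solve-∀
      m′-m≡[1+k]n : + m′ ℤ.- + m ≡ + suc k ℤ.* + n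
      m′-m≡[1+k]n = ≡.trans (flip (+ m) (+ m′)) (≡.trans (cong ℤ.-_ eq) (ℤ.neg-distribˡ-* -[1+ k ] (+ n)))

    ^≈ζ^ℤ : ∀ m i → + n ∣ℤ + m ℤ.- i → ζ ^ m ≈ ζ^ℤ i
    ^≈ζ^ℤ m i n∣m-i = ^-cong-∣ m (i %ℕ n) (∣i-j∣j-k⇒∣i-k (+ m) i (+ (i %ℕ n)) n∣m-i (n∣i-i%ℕn i n))

    homo-ζ^ℤ-inverse : ∀ {f} → IsRingHomomorphism f → f ζ ≈ ζ ^ (n ∸ 1) →
                       ∀ e → f (ζ^ℤ e) ≈ ζ^ℤ (ℤ.- e)
    homo-ζ^ℤ-inverse {f} f-homo fζ≈ζ⁻¹ e = begin
      f (ζ ^ r)          ≈⟨ homo-^ f-homo ζ r ⟩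
      f ζ ^ r            ≈⟨ ^-congˡ r fζ≈ζ⁻¹ ⟩
      (ζ ^ (n ∸ 1)) ^ r  ≈⟨ ^-assocʳ ζ (n ∸ 1) r ⟩
      ζ ^ ((n ∸ 1) * r)  ≈⟨ ^≈ζ^ℤ ((n ∸ 1) * r) (ℤ.- e) n∣[n-1]r+e ⟩
      ζ^ℤ (ℤ.- e)        ∎
      where
      r = e %ℕ n
      flip : ∀ i j → i ℤ.- j ≡ ℤ.- j ℤ.- ℤ.- i
      flip = solve-∀
      n∣[n-1]r+e : + n ∣ℤ + ((n ∸ 1) * r) ℤ.- ℤ.- e
      n∣[n-1]r+e = ∣i-j∣j-k⇒∣i-k (+ ((n ∸ 1) * r)) (ℤ.- + r) (ℤ.- e)
                     (n∣[n∸1]m+m n r) (≡.subst (+ n ∣ℤ_) (flip e (+ r)) (n∣i-i%ℕn e n))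

  module Twist (p q d : ℕ) .{{_ : NonZero p}} .{{_ : NonZero q}}
               (ζ : Carrier) (ζᵖᵠ≈1 : ζ ^ (p * q) ≈ 1#)
               {σ : Carrier → Carrier} (σ-homo : IsRingHomomorphism σ)
               (σζ^q≈ζ^q : σ (ζ ^ q) ≈ ζ ^ q) (σζ^p≈ζ^pd : σ (ζ ^ p) ≈ ζ ^ (p * d)) where

    private instance
      pq≢0 : NonZero (p * q)
      pq≢0 = ℕ.m*n≢0 p q

    open RootOfUnity (p * q) ζ ζᵖᵠ≈1
    open IsRingHomomorphism σ-homo using (⟦⟧-cong; *-homo)

    ^-split : ∀ m u v → ζ ^ (q * u + m * v) ≈ (ζ ^ q) ^ u · (ζ ^ m) ^ v
    ^-split m u v = trans (^-homo-* ζ (q * u) (m * v)) (*-cong (sym (^-assocʳ ζ q u)) (sym (^-assocʳ ζ m v)))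

    σ-^ : ∀ u v → σ (ζ ^ (q * u + p * v)) ≈ ζ ^ (q * u + (p * d) * v)
    σ-^ u v = begin
      σ (ζ ^ (q * u + p * v))            ≈⟨ ⟦⟧-cong (^-split p u v) ⟩
      σ ((ζ ^ q) ^ u · (ζ ^ p) ^ v)      ≈⟨ *-homo _ _ ⟩
      σ ((ζ ^ q) ^ u) · σ ((ζ ^ p) ^ v)  ≈⟨ *-cong (homo-^ σ-homo _ u) (homo-^ σ-homo _ v) ⟩
      σ (ζ ^ q) ^ u · σ (ζ ^ p) ^ v      ≈⟨ *-cong (^-congˡ u σζ^q≈ζ^q) (^-congˡ v σζ^p≈ζ^pd) ⟩
      (ζ ^ q) ^ u · (ζ ^ (p * d)) ^ v    ≈⟨ ^-split (p * d) u v ⟨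
      ζ ^ (q * u + (p * d) * v)          ∎

    -- Reducing x mod p and y mod q turns both sides into natural powers of ζ, on which σ acts
    -- through its values at ζ^q and ζ^p.
    σ-ζ^ℤ : ∀ x y y′ → + q ∣ℤ + d ℤ.* y ℤ.- y′ →
            σ (ζ^ℤ (+ q ℤ.* x ℤ.+ + p ℤ.* y)) ≈ ζ^ℤ (+ q ℤ.* x ℤ.+ + p ℤ.* y′)
    σ-ζ^ℤ x y y′ q∣dy-y′ = begin
      σ (ζ^ℤ (+ q ℤ.* x ℤ.+ + p ℤ.* y))  ≈⟨ ⟦⟧-cong (sym (^≈ζ^ℤ (q * u + p * v) (+ q ℤ.* x ℤ.+ + p ℤ.* y) before)) ⟩
      σ (ζ ^ (q * u + p * v))            ≈⟨ σ-^ u v ⟩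
      ζ ^ (q * u + (p * d) * v)          ≈⟨ ^≈ζ^ℤ (q * u + (p * d) * v) (+ q ℤ.* x ℤ.+ + p ℤ.* y′) after ⟩
      ζ^ℤ (+ q ℤ.* x ℤ.+ + p ℤ.* y′)     ∎
      where
      u = x %ℕ p
      v = y %ℕ q
      u≡x : + p ∣ℤ + u ℤ.- x
      u≡x = ∣i-j⇒∣j-i x (+ u) (n∣i-i%ℕn x p)
      v≡y : + q ∣ℤ + v ℤ.- y
      v≡y = ∣i-j⇒∣j-i y (+ v) (n∣i-i%ℕn y q)
      dv≡y′ : + q ∣ℤ + d ℤ.* + v ℤ.- y′
      dv≡y′ = ≡.subst (+ q ∣ℤ_) (regroup (+ d) (+ v) y y′)
                (∣m∣n⇒∣m+n (∣n⇒∣m*n (+ d) v≡y) q∣dy-y′)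
        where
        regroup : ∀ d v y y′ → d ℤ.* (v ℤ.- y) ℤ.+ (d ℤ.* y ℤ.- y′) ≡ d ℤ.* v ℤ.- y′
        regroup = solve-∀
      cast : ∀ m → + q ℤ.* + u ℤ.+ + m ℤ.* + v ≡ + (q * u + m * v)
      cast m = ≡.sym (≡.trans (ℤ.pos-+ (q * u) (m * v)) (cong₂ ℤ._+_ (ℤ.pos-* q u) (ℤ.pos-* m v)))
      before : + (p * q) ∣ℤ + (q * u + p * v) ℤ.- (+ q ℤ.* x ℤ.+ + p ℤ.* y)
      before = ≡.subst (λ z → + (p * q) ∣ℤ z ℤ.- (+ q ℤ.* x ℤ.+ + p ℤ.* y)) (cast p) (qx+py-cong p q u≡x v≡y)
      after : + (p * q) ∣ℤ + (q * u + (p * d) * v) ℤ.- (+ q ℤ.* x ℤ.+ + p ℤ.* y′)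
      after = ≡.subst (λ z → + (p * q) ∣ℤ z ℤ.- (+ q ℤ.* x ℤ.+ + p ℤ.* y′))
                (≡.trans (cong (λ w → + q ℤ.* + u ℤ.+ w) (≡.trans (≡.sym (ℤ.*-assoc (+ p) (+ d) (+ v)))
                                                                  (cong (ℤ._* + v) (≡.sym (ℤ.pos-* p d)))))
                         (cast (p * d)))
                (qx+py-cong p q u≡x dv≡y′)

-- The blocks of α

module _ {c ℓ : Level} (R : CommutativeRing c ℓ) where
  open CommutativeRing R hiding (_+_; _*_)
  open RingDefs R
  open RingMorphisms rawRing rawRing using (IsRingHomomorphism)
  open RingPowers R

  mapM-blockDiag : ∀ (f : Carrier → Carrier) {B B′ : ℕ → Mat} → f 0# ≈ 0# →
                   (∀ i x y → f (B i x y) ≈ B′ i x y) → ∀ r s → mapM f (blockDiag B) r s ≈ blockDiag B′ r s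
  mapM-blockDiag f f0≈0 fB≈B′ r s with r / 2 ℕ.≟ s / 2
  ... | yes _ = fB≈B′ (suc (r / 2)) (r % 2) (s % 2)
  ... | no  _ = f0≈0

  module Blocks (p q : ℕ) .{{_ : NonZero p}} .{{_ : NonZero q}} (ζ : Carrier) (ζᵖᵠ≈1 : ζ ^ (p * q) ≈ 1#) where

    private instance
      pq≢0 : NonZero (p * q)
      pq≢0 = ℕ.m*n≢0 p q

    open RootOfUnity (p * q) ζ ζᵖᵠ≈1

    map-Zpow : ∀ {f : Carrier → Carrier} {e e′} →
               f 0# ≈ 0# → f (ζ^ℤ e) ≈ ζ^ℤ e′ → f (ζ^ℤ (ℤ.- e)) ≈ ζ^ℤ (ℤ.- e′) →
               ∀ x y → f (Zpow ζ p q e x y) ≈ Zpow ζ p q e′ x y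
    map-Zpow f0≈0 f₀₀ f₁₁ 0             0             = f₀₀
    map-Zpow f0≈0 f₀₀ f₁₁ 1             1             = f₁₁
    map-Zpow f0≈0 f₀₀ f₁₁ 0             (suc _)       = f0≈0
    map-Zpow f0≈0 f₀₀ f₁₁ 1             0             = f0≈0
    map-Zpow f0≈0 f₀₀ f₁₁ 1             (suc (suc _)) = f0≈0
    map-Zpow f0≈0 f₀₀ f₁₁ (suc (suc _)) _             = f0≈0

    conj-Zpow : ∀ {conj} → IsRingHomomorphism conj → conj ζ ≈ ζ ^ (p * q ∸ 1) →
                ∀ e x y → conj (Zpow ζ p q e x y) ≈ Zpow ζ p q (ℤ.- e) x y
    conj-Zpow {conj} conj-homo conjζ≈ζ⁻¹ e =
      map-Zpow {conj} {e} 0#-homo (homo-ζ^ℤ-inverse conj-homo conjζ≈ζ⁻¹ e)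
                                   (homo-ζ^ℤ-inverse conj-homo conjζ≈ζ⁻¹ (ℤ.- e))
      where open IsRingHomomorphism conj-homo using (0#-homo)

    αexp : ℕ → ℕ → ℤ
    αexp a b = + (q * (a + 1)) ℤ.- + (p * b)

    αexp-cast : ∀ a b → αexp a b ≡ + q ℤ.* (+ a ℤ.+ ℤ.1ℤ) ℤ.- + p ℤ.* + b
    αexp-cast a b = cong₂ ℤ._-_ (ℤ.pos-* q (a + 1)) (ℤ.pos-* p b)

    αexp≡qx+py : ∀ a b → αexp a b ≡ + q ℤ.* (+ a ℤ.+ ℤ.1ℤ) ℤ.+ + p ℤ.* ℤ.- + b
    αexp≡qx+py a b = ≡.trans (αexp-cast a b) (neg-inside (+ q ℤ.* (+ a ℤ.+ ℤ.1ℤ)) (+ p) (+ b))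
      where
      neg-inside : ∀ x p b → x ℤ.- p ℤ.* b ≡ x ℤ.+ p ℤ.* ℤ.- b
      neg-inside = solve-∀

    -αexp≡qx+py : ∀ a b → ℤ.- αexp a b ≡ + q ℤ.* ℤ.- (+ a ℤ.+ ℤ.1ℤ) ℤ.+ + p ℤ.* + b
    -αexp≡qx+py a b = ≡.trans (cong ℤ.-_ (αexp-cast a b)) (negate (+ q) (+ a ℤ.+ ℤ.1ℤ) (+ p) (+ b))
      where
      negate : ∀ q x p b → ℤ.- (q ℤ.* x ℤ.- p ℤ.* b) ≡ q ℤ.* ℤ.- x ℤ.+ p ℤ.* b
      negate = solve-∀

    αexp-complement : ∀ {a a′ t t′} → suc a + suc a′ ≡ p → t + t′ ≡ q → αexp a t ≡ ℤ.- αexp a′ t′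
    αexp-complement {a} {a′} {t} {t′} a+a′≡p t+t′≡q = m-n≡-[m′-n′] {q * (a + 1)} {p * t}
      (≡.trans (cong₂ (λ x y → q * x + q * y) (ℕ.+-comm a 1) (ℕ.+-comm a′ 1)) (complement-sum a+a′≡p t+t′≡q))

    module Galois (d : ℕ) {σ : Carrier → Carrier} (σ-homo : IsRingHomomorphism σ)
             (σζ^q≈ζ^q : σ (ζ ^ q) ≈ ζ ^ q) (σζ^p≈ζ^pd : σ (ζ ^ p) ≈ ζ ^ (p * d)) where

      open Twist p q d ζ ζᵖᵠ≈1 σ-homo σζ^q≈ζ^q σζ^p≈ζ^pd using (σ-ζ^ℤ)
      open IsRingHomomorphism σ-homo using (0#-homo)

      q∣db-db%q : ∀ b → + q ∣ℤ + d ℤ.* + b ℤ.- + ((d * b) % q)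
      q∣db-db%q b = divides (+ ((d * b) / q)) (begin
        + d ℤ.* + b ℤ.- + t        ≡⟨ cong (ℤ._- + t) (ℤ.pos-* d b) ⟨
        + (d * b) ℤ.- + t          ≡⟨ cong (λ m → + m ℤ.- + t) (m≡m%n+[m/n]*n (d * b) q) ⟩
        + t ℤ.+ + (K * q) ℤ.- + t  ≡⟨ cancel (+ t) (+ (K * q)) ⟩
        + (K * q)                  ≡⟨ ℤ.pos-* K q ⟩
        + K ℤ.* + q                ∎)
        where
        open ≡.≡-Reasoning
        t = (d * b) % q
        K = (d * b) / q
        cancel : ∀ t x → t ℤ.+ x ℤ.- t ≡ x
        cancel = solve-∀

      q∣d[-b]+db%q : ∀ b → + q ∣ℤ + d ℤ.* ℤ.- + b ℤ.- ℤ.- + ((d * b) % q)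
      q∣d[-b]+db%q b = ≡.subst (+ q ∣ℤ_) (negate (+ d) (+ b) (+ ((d * b) % q))) (∣m⇒∣-m (q∣db-db%q b))
        where
        negate : ∀ d b t → ℤ.- (d ℤ.* b ℤ.- t) ≡ d ℤ.* ℤ.- b ℤ.- ℤ.- t
        negate = solve-∀

      σ-Zpow-αexp : ∀ a b x y → σ (Zpow ζ p q (αexp a b) x y) ≈ Zpow ζ p q (αexp a ((d * b) % q)) x y
      σ-Zpow-αexp a b = map-Zpow {σ} {αexp a b} 0#-homo
        (begin
          σ (ζ^ℤ (αexp a b))                                    ≡⟨ cong (σ ∘ ζ^ℤ) (αexp≡qx+py a b) ⟩
          σ (ζ^ℤ (+ q ℤ.* (+ a ℤ.+ ℤ.1ℤ) ℤ.+ + p ℤ.* ℤ.- + b))  ≈⟨ σ-ζ^ℤ _ (ℤ.- + b) (ℤ.- + t) (q∣d[-b]+db%q b) ⟩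
          ζ^ℤ (+ q ℤ.* (+ a ℤ.+ ℤ.1ℤ) ℤ.+ + p ℤ.* ℤ.- + t)      ≡⟨ cong ζ^ℤ (αexp≡qx+py a t) ⟨
          ζ^ℤ (αexp a t)                                        ∎)
        (begin
          σ (ζ^ℤ (ℤ.- αexp a b))                                ≡⟨ cong (σ ∘ ζ^ℤ) (-αexp≡qx+py a b) ⟩
          σ (ζ^ℤ (+ q ℤ.* ℤ.- (+ a ℤ.+ ℤ.1ℤ) ℤ.+ + p ℤ.* + b))  ≈⟨ σ-ζ^ℤ _ (+ b) (+ t) (q∣db-db%q b) ⟩
          ζ^ℤ (+ q ℤ.* ℤ.- (+ a ℤ.+ ℤ.1ℤ) ℤ.+ + p ℤ.* + t)      ≡⟨ cong ζ^ℤ (-αexp≡qx+py a t) ⟨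
          ζ^ℤ (ℤ.- αexp a t)                                    ∎)
        where
        open import Relation.Binary.Reasoning.Setoid setoid
        t = (d * b) % q

  module Proposition (p q : ℕ) ⦃ _ : NonZero p ⦄ ⦃ _ : NonZero q ⦄
                     (p-prime : Prime p) (q-prime : Prime q) (2∤q : ¬ (2 ∣ q)) (p≢q : p ≢ q)
                     (d : ℕ) (d-generator : IsGeneratorMod q d)
                     (ζ : Carrier) (ζᵖᵠ≈1 : ζ ^ (p * q) ≈ 1#)
                     {σ : Carrier → Carrier} (σ-homo : IsRingHomomorphism σ)
                     (σζ^q≈ζ^q : σ (ζ ^ q) ≈ ζ ^ q) (σζ^p≈ζ^pd : σ (ζ ^ p) ≈ ζ ^ (p * d))
                     {conj : Carrier → Carrier} (conj-homo : IsRingHomomorphism conj)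
                     (conjζ≈ζ⁻¹ : conj ζ ≈ ζ ^ (p * q ∸ 1)) where

    open Blocks p q ζ ζᵖᵠ≈1
    open Galois d σ-homo σζ^q≈ζ^q σζ^p≈ζ^pd using (σ-Zpow-αexp)
    open PairList p q using (pairAt-index; pairAt-valid)
    open IsRingHomomorphism σ-homo using (0#-homo)

    αblk-at : ∀ {i a b} → pairAt p q i ≡ just (a , b) → αblk ζ p q i ≡ Zpow ζ p q (αexp a b)
    αblk-at pair≡ rewrite pair≡ = ≡.refl

    αblk-index : ∀ {a b} → IsPair p q a b → αblk ζ p q (κ p q (b ∸ 1) + a + 1) ≡ Zpow ζ p q (αexp a b)
    αblk-index {a} {b} ab-pair =
      ≡.trans (cong (αblk ζ p q) (ℕ.+-comm (κ p q (b ∸ 1) + a) 1)) (αblk-at (pairAt-index ab-pair))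

    ι₂-index : ∀ k {a a′} → suc a + suc a′ ≡ p → + k ℤ.+ + p ℤ.- (+ a ℤ.+ ℤ.1ℤ) ≡ + (k + a′ + 1)
    ι₂-index k {a} {a′} a+a′≡p = ≡.trans (cong (λ m → + k ℤ.+ + m ℤ.- (+ a ℤ.+ ℤ.1ℤ)) (≡.sym a+a′≡p))
                                          (cancel (+ k) (+ a) (+ a′))
      where
      cancel : ∀ k a a′ → k ℤ.+ ((ℤ.1ℤ ℤ.+ a) ℤ.+ (ℤ.1ℤ ℤ.+ a′)) ℤ.- (a ℤ.+ ℤ.1ℤ) ≡ k ℤ.+ a′ ℤ.+ ℤ.1ℤ
      cancel = solve-∀

    d>0 : 0 < d
    d>0 = generator>0 (odd-prime>2 q-prime 2∤q) d-generator

    module _ {a b : ℕ} (ab-pair : IsPair p q a b) where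

      private
        t = (d * b) % q
        0<b = proj₁ ab-pair
        b<q = proj₁ (proj₂ ab-pair)
        0<t : 0 < t
        0<t = d*b%q>0 q-prime d>0 (proj₁ d-generator) 0<b b<q
        t<q : t < q
        t<q = m%n<n (d * b) q
        t′ = q ∸ t
        ι₂ = + κ p q (t′ ∸ 1) ℤ.+ + p ℤ.- (+ a ℤ.+ ℤ.1ℤ)

      σ-block-≤ : q * suc a < p * t → ∀ x y →
                  σ (Zpow ζ p q (αexp a b) x y) ≈ αblk ζ p q (κ p q (t ∸ 1) + a + 1) x y
      σ-block-≤ qa<pt x y = trans (σ-Zpow-αexp a b x y)
                                  (reflexive (cong (λ B → B x y) (≡.sym (αblk-index (0<t , t<q , qa<pt)))))

      σ-block-> : ¬ (q * suc a < p * t) → ∀ x y → σ (Zpow ζ p q (αexp a b) x y) ≈ conj (αblkℤ ζ p q ι₂ x y)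
      σ-block-> qa≮pt x y = begin
        σ (Zpow ζ p q (αexp a b) x y)                    ≈⟨ σ-Zpow-αexp a b x y ⟩
        Zpow ζ p q (αexp a t) x y                        ≡⟨ cong (λ e → Zpow ζ p q e x y) (αexp-complement a+a′≡p t+t′≡q) ⟩
        Zpow ζ p q (ℤ.- αexp a′ t′) x y                  ≈⟨ conj-Zpow conj-homo conjζ≈ζ⁻¹ (αexp a′ t′) x y ⟨
        conj (Zpow ζ p q (αexp a′ t′) x y)               ≡⟨ cong (λ B → conj (B x y)) (αblk-index a′t′-pair) ⟨
        conj (αblk ζ p q (κ p q (t′ ∸ 1) + a′ + 1) x y)  ≡⟨ cong (λ ι → conj (αblkℤ ζ p q ι x y)) ι₂≡ ⟨
        conj (αblkℤ ζ p q ι₂ x y)                        ∎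
        where
        open import Relation.Binary.Reasoning.Setoid setoid
        1+a<p : suc a < p
        1+a<p = q*[1+a]<p*b⇒1+a<p (proj₂ (proj₂ ab-pair)) b<q
        a′ = p ∸ suc (suc a)
        a+a′≡p : suc a + suc a′ ≡ p
        a+a′≡p = ≡.trans (ℕ.+-suc (suc a) a′) (ℕ.m+[n∸m]≡n 1+a<p)
        t+t′≡q : t + t′ ≡ q
        t+t′≡q = ℕ.m+[n∸m]≡n (ℕ.<⇒≤ t<q)
        pt<qa : p * t < q * suc a
        pt<qa = ℕ.≤∧≢⇒< (ℕ.≮⇒≥ qa≮pt) (p*t≢q*s t p-prime q-prime p≢q z<s 1+a<p)
        ι₂≡ : ι₂ ≡ + (κ p q (t′ ∸ 1) + a′ + 1)
        ι₂≡ = ι₂-index (κ p q (t′ ∸ 1)) a+a′≡p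
        a′t′-pair : IsPair p q a′ t′
        a′t′-pair = ℕ.m<n⇒0<n∸m t<q , ℕ.∸-monoʳ-< 0<t (ℕ.<⇒≤ t<q) , complement-< a+a′≡p t+t′≡q pt<qa

    σ-αblk≈βblk : ∀ i x y → σ (αblk ζ p q i x y) ≈ βblk ζ p q d conj i x y
    σ-αblk≈βblk i x y with pairAt p q i in pair≡
    ... | nothing = 0#-homo
    ... | just (a , b) with + a ℤ.≤? kk p q ((d * b) % q)
    ...   | yes a≤k = σ-block-≤ (pairAt-valid i pair≡) (Equivalence.to (≤kk⇔ p q a _) a≤k) x y
    ...   | no  a≰k with kk p q ((d * b) % q) ℤ.<? + a
    ...     | yes _   = σ-block-> (pairAt-valid i pair≡) (a≰k ∘ Equivalence.from (≤kk⇔ p q a _)) x y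
    ...     | no  k≮a = contradiction (ℤ.≰⇒> a≰k) k≮a

    σα≈β : ∀ r s → mapM σ (α ζ p q) r s ≈ β ζ p q d conj r s
    σα≈β = mapM-blockDiag σ 0#-homo σ-αblk≈βblk

proposition3p5 :
  ∀ {c ℓ : Level} (R : CommutativeRing c ℓ)
  (p q : ℕ) ⦃ _ : NonZero p ⦄ ⦃ _ : NonZero q ⦄ →
  Prime p → Prime q → ¬ (2 ∣ p) → ¬ (2 ∣ q) → p ≢ q →
  (d : ℕ) → IsGeneratorMod q d →
  let open CommutativeRing R hiding (_*_)
      open RingDefs R
      open RingMorphisms rawRing rawRing
  in
  (ζ : Carrier) → ζ ^ (p * q) ≈ 1# →
  (σ : Carrier → Carrier) → IsRingIsomorphism σ →
  σ (ζ ^ q) ≈ ζ ^ q → σ (ζ ^ p) ≈ ζ ^ (p * d) →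
  (conj : Carrier → Carrier) → IsRingIsomorphism conj →
  conj ζ ≈ ζ ^ (p * q ∸ 1) →
  ∀ r s → r < 2 * genus p q → s < 2 * genus p q →
  mapM σ (α ζ p q) r s ≈ β ζ p q d conj r s
proposition3p5 R p q p-prime q-prime _ 2∤q p≢q d d-generator ζ ζᵖᵠ≈1
               σ σ-iso σζ^q≈ζ^q σζ^p≈ζ^pd conj conj-iso conjζ≈ζ⁻¹ r s _ _ =
  Proposition.σα≈β R p q p-prime q-prime 2∤q p≢q d d-generator ζ ζᵖᵠ≈1
    (isRingHomomorphism σ-iso) σζ^q≈ζ^q σζ^p≈ζ^pd (isRingHomomorphism conj-iso) conjζ≈ζ⁻¹ r s
  where
  open CommutativeRing R using (rawRing)
  open RingMorphisms rawRing rawRing using (module IsRingIsomorphism)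
  open IsRingIsomorphism using (isRingHomomorphism)
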